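{- Let $k\ge 10^3$ and $\rho=10^{ -8}$. For every $\epsilon\ge 0$ and every $k$-coloring $f\colon[k]^2\to[k]$ that is $\epsilon$-far from being striped, the stripe verifier rejects $f$ with probability more than $\frac{\rho\cdot\epsilon}{k}$.
   Context: A $k$-coloring $f\colon[k]^2\to[k]$ is horizontally striped if there is a permutation $\sigma$ of $[k]$ with $f(x,y)=\sigma(y)$ for all $(x,y)$, vertically striped if $f(x,y)=\sigma(x)$ for all $(x,y)$ for some permutation $\sigma$, and striped if it is either. For functions $f,g$ on a finite domain $\mathcal D$, the relative Hamming distance is $\delta(f,g)=\Pr_{x\sim\mathcal D}[f(x)\ne g(x)]$; $f$ is $\epsilon$-far from being striped if $\min_g\delta(f,g)>\epsilon$, the minimum over all striped $g$. The stripe verifier, given oracle access to $f$, selects $(x_1,y_1),(x_2,y_2)\in[k]^2$ uniformly at random subject to $x_1\ne x_2$ and $y_1\ne y_2$, rejects if $f(x_1,y_1)=f(x_2,y_2)$ and accepts otherwise.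
   Formalization: The parameter ε ranges over the nonnegative rationals. -}

module Defs where

open import Data.Nat using (ℕ; zero; suc; _+_; _*_)
open import Data.Fin using (Fin; zero; suc)
open import Data.Fin.Properties using (_≟_)
open import Data.Fin.Permutation using (Permutation′; _⟨$⟩ʳ_)
open import Data.Integer using (+_)
open import Data.Rational using (ℚ; _/_; 0ℚ)
open import Data.Product using (∃; _×_)
open import Data.Sum using (_⊎_)
open import Data.Bool using (Bool; true; false; if_then_else_; _∧_; not)
open import Relation.Nullary.Decidable using (⌊_⌋)
open import Relation.Binary.PropositionalEquality using (_≡_)

-- a / b as a rational, with the convention a / 0 = 0 (only used with b > 0)
frac : ℕ → ℕ → ℚ
frac a zero = 0ℚ
frac a (suc b) = + a / suc b

sumFin : (n : ℕ) → (Fin n → ℕ) → ℕ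
sumFin zero h = 0
sumFin (suc n) h = h zero + sumFin n (λ i → h (suc i))

ind : Bool → ℕ
ind true = 1
ind false = 0

Coloring : ℕ → Set
Coloring k = Fin k → Fin k → Fin k

HorizontallyStriped : {k : ℕ} → Coloring k → Set
HorizontallyStriped {k} g = ∃ λ (σ : Permutation′ k) → ∀ x y → g x y ≡ σ ⟨$⟩ʳ y

VerticallyStriped : {k : ℕ} → Coloring k → Set
VerticallyStriped {k} g = ∃ λ (σ : Permutation′ k) → ∀ x y → g x y ≡ σ ⟨$⟩ʳ x

Striped : {k : ℕ} → Coloring k → Set
Striped g = HorizontallyStriped g ⊎ VerticallyStriped g

δ : {k : ℕ} → Coloring k → Coloring k → ℚ
δ {k} f g = frac (sumFin k λ x → sumFin k λ y → ind (not ⌊ f x y ≟ g x y ⌋)) (k * k)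

-- f is ε-far from striped: min over striped g of δ(f,g) exceeds ε
-- (the minimum over the finite nonempty set of striped g is > ε iff every striped g has δ > ε)
Far : {k : ℕ} → ℚ → Coloring k → Set
Far ε f = ∀ g → Striped g → ε Data.Rational.< δ f g

sumValid : (k : ℕ) → (Fin k → Fin k → Fin k → Fin k → Bool) → ℕ
sumValid k P = sumFin k λ x₁ → sumFin k λ y₁ → sumFin k λ x₂ → sumFin k λ y₂ →
  ind (not ⌊ x₁ ≟ x₂ ⌋ ∧ not ⌊ y₁ ≟ y₂ ⌋ ∧ P x₁ y₁ x₂ y₂)

rejectProb : {k : ℕ} → Coloring k → ℚ
rejectProb {k} f =
  frac (sumValid k λ x₁ y₁ x₂ y₂ → ⌊ f x₁ y₁ ≟ f x₂ y₂ ⌋)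
       (sumValid k λ _ _ _ _ → true)

ρ : ℚ
ρ = frac 1 100000000

module Submission where

-- Call a cell horizontal if its colour fills more than 7/8 of its row, occurs nowhere else in its
-- column, and the cell lies in fewer than k/8 rejected pairs; vertical cells are the transposed notion
-- and all other cells are irregular. The colour classes have sizes summing to k², so by Cauchy–Schwarz
-- the class sizes seen from all k² cells sum to at least k³. Seen from a cell, its class consists of the
-- cell, its row and column mates and its rejecting partners, and each pair (row mate, column mate) of a
-- cell is itself a rejected pair; a cell-wise case analysis then gives k·#irregular ≤ 24·R, where R is
-- the number of rejected pairs. Horizontal cells of one row share their colour, while different rows,
-- and horizontal versus vertical cells, never do. So if at least as many rows carry horizontal cells as
-- columns carry vertical ones, the row colours extend to a permutation whose horizontal stripe differs
-- from f in at most 5·#irregular cells (otherwise transpose). Hence k·dist(f, striped) ≤ 120·R, and as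
-- there are at most k⁴ valid pairs and ρ ≤ 1/120, the rejection probability exceeds ρ·ε/k.

open import Defs

module Sums where

  open import Data.Nat using (ℕ; zero; suc; _+_; _*_; _≤_; z≤n)
  open import Data.Nat.Properties
  open import Algebra.Properties.CommutativeSemigroup +-commutativeSemigroup using (interchange)
  open import Data.Nat.Tactic.RingSolver using (solve-∀)
  open import Data.Fin using (Fin; zero; suc)
  open import Data.Product using (_,_)
  open import Data.Sum using (inj₁; inj₂)
  open import Function using (_∘_)
  open import Relation.Binary.PropositionalEquality

  sumFin-cong : ∀ n {F G : Fin n → ℕ} → (∀ i → F i ≡ G i) → sumFin n F ≡ sumFin n G
  sumFin-cong zero    eq = refl
  sumFin-cong (suc n) eq = cong₂ _+_ (eq zero) (sumFin-cong n (eq ∘ suc))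

  sumFin-mono-≤ : ∀ n {F G : Fin n → ℕ} → (∀ i → F i ≤ G i) → sumFin n F ≤ sumFin n G
  sumFin-mono-≤ zero    le = z≤n
  sumFin-mono-≤ (suc n) le = +-mono-≤ (le zero) (sumFin-mono-≤ n (le ∘ suc))

  sumFin-distrib-+ : ∀ n (F G : Fin n → ℕ) →
    sumFin n (λ i → F i + G i) ≡ sumFin n F + sumFin n G
  sumFin-distrib-+ zero    F G = refl
  sumFin-distrib-+ (suc n) F G =
    trans (cong (F zero + G zero +_) (sumFin-distrib-+ n (F ∘ suc) (G ∘ suc)))
          (interchange (F zero) (G zero) _ _)

  *-distribˡ-sumFin : ∀ n c (F : Fin n → ℕ) → c * sumFin n F ≡ sumFin n (λ i → c * F i)
  *-distribˡ-sumFin zero    c F = *-zeroʳ c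
  *-distribˡ-sumFin (suc n) c F =
    trans (*-distribˡ-+ c (F zero) _) (cong (c * F zero +_) (*-distribˡ-sumFin n c (F ∘ suc)))

  sumFin-const : ∀ n c → sumFin n (λ _ → c) ≡ n * c
  sumFin-const zero    c = refl
  sumFin-const (suc n) c = cong (c +_) (sumFin-const n c)

  sumFin-zero : ∀ n → sumFin n (λ _ → 0) ≡ 0
  sumFin-zero n = trans (sumFin-const n 0) (*-zeroʳ n)

  sumFin-comm : ∀ m n (F : Fin m → Fin n → ℕ) →
    sumFin m (λ i → sumFin n (F i)) ≡ sumFin n (λ j → sumFin m (λ i → F i j))
  sumFin-comm zero    n F = sym (sumFin-zero n)
  sumFin-comm (suc m) n F =
    trans (cong (sumFin n (F zero) +_) (sumFin-comm m n (F ∘ suc)))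
          (sym (sumFin-distrib-+ n (F zero) _))

  term≤sumFin : ∀ n (F : Fin n → ℕ) i → F i ≤ sumFin n F
  term≤sumFin (suc n) F zero    = m≤m+n _ _
  term≤sumFin (suc n) F (suc i) = m≤n⇒m≤o+n (F zero) (term≤sumFin n (F ∘ suc) i)

  sumFin-product : ∀ m n (F : Fin m → ℕ) (G : Fin n → ℕ) →
    sumFin m (λ i → sumFin n (λ j → F i * G j)) ≡ sumFin m F * sumFin n G
  sumFin-product m n F G = begin
    sumFin m (λ i → sumFin n (λ j → F i * G j)) ≡⟨ sumFin-cong m (λ i → sym (*-distribˡ-sumFin n (F i) G)) ⟩
    sumFin m (λ i → F i * sumFin n G)           ≡⟨ sumFin-cong m (λ i → *-comm (F i) _) ⟩
    sumFin m (λ i → sumFin n G * F i)           ≡⟨ *-distribˡ-sumFin m (sumFin n G) F ⟨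
    sumFin n G * sumFin m F                     ≡⟨ *-comm _ (sumFin m F) ⟩
    sumFin m F * sumFin n G                     ∎
    where open ≡-Reasoning

  am-gm-≤ : ∀ {a b} → a ≤ b → 2 * a * b ≤ a * a + b * b
  am-gm-≤ {a} a≤b with d , refl ← m≤n⇒∃[o]m+o≡n a≤b =
    subst (2 * a * (a + d) ≤_) (square-sum a d) (m≤m+n _ (d * d))
    where
    square-sum : ∀ a d → 2 * a * (a + d) + d * d ≡ a * a + (a + d) * (a + d)
    square-sum = solve-∀

  am-gm : ∀ a b → 2 * a * b ≤ a * a + b * b
  am-gm a b with ≤-total a b
  ... | inj₁ a≤b = am-gm-≤ a≤b
  ... | inj₂ b≤a = subst₂ _≤_ (swap-2ab b a) (+-comm (b * b) (a * a)) (am-gm-≤ b≤a)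
    where
    swap-2ab : ∀ b a → 2 * b * a ≡ 2 * a * b
    swap-2ab = solve-∀

  sumFin-squares : ∀ n a (s : Fin n → ℕ) →
    2 * a * sumFin n s ≤ n * (a * a) + sumFin n (λ i → s i * s i)
  sumFin-squares n a s = begin
    2 * a * sumFin n s                                    ≡⟨ *-distribˡ-sumFin n (2 * a) s ⟩
    sumFin n (λ i → 2 * a * s i)                          ≤⟨ sumFin-mono-≤ n (λ i → am-gm a (s i)) ⟩
    sumFin n (λ i → a * a + s i * s i)                    ≡⟨ sumFin-distrib-+ n _ _ ⟩
    sumFin n (λ _ → a * a) + sumFin n (λ i → s i * s i)  ≡⟨ cong (_+ _) (sumFin-const n (a * a)) ⟩
    n * (a * a) + sumFin n (λ i → s i * s i)              ∎
    where open ≤-Reasoning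

  sumGrid : ∀ {n} → (Fin n → Fin n → ℕ) → ℕ
  sumGrid {n} F = sumFin n λ x → sumFin n λ y → F x y

  module _ {n : ℕ} where

    sumGrid-cong : {F G : Fin n → Fin n → ℕ} → (∀ x y → F x y ≡ G x y) → sumGrid F ≡ sumGrid G
    sumGrid-cong eq = sumFin-cong n (λ x → sumFin-cong n (eq x))

    sumGrid-mono-≤ : {F G : Fin n → Fin n → ℕ} → (∀ x y → F x y ≤ G x y) → sumGrid F ≤ sumGrid G
    sumGrid-mono-≤ le = sumFin-mono-≤ n (λ x → sumFin-mono-≤ n (le x))

    sumGrid-distrib-+ : (F G : Fin n → Fin n → ℕ) → sumGrid (λ x y → F x y + G x y) ≡ sumGrid F + sumGrid G
    sumGrid-distrib-+ F G = trans (sumFin-cong n (λ x → sumFin-distrib-+ n (F x) (G x))) (sumFin-distrib-+ n _ _)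

    *-distribˡ-sumGrid : ∀ c (F : Fin n → Fin n → ℕ) → c * sumGrid F ≡ sumGrid (λ x y → c * F x y)
    *-distribˡ-sumGrid c F = trans (*-distribˡ-sumFin n c _) (sumFin-cong n (λ x → *-distribˡ-sumFin n c (F x)))

    sumGrid-const : ∀ c → sumGrid {n} (λ _ _ → c) ≡ n * (n * c)
    sumGrid-const c = trans (sumFin-cong n (λ _ → sumFin-const n c)) (sumFin-const n _)

    term≤sumGrid : (F : Fin n → Fin n → ℕ) (x y : Fin n) → F x y ≤ sumGrid F
    term≤sumGrid F x y = ≤-trans (term≤sumFin n (F x) y) (term≤sumFin n (λ x → sumFin n (F x)) x)

    sumGrid-row : (G : Fin n → ℕ) → sumGrid (λ _ y → G y) ≡ n * sumFin n G
    sumGrid-row G = sumFin-const n _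

    sumGrid-column : (G : Fin n → ℕ) → sumGrid (λ x _ → G x) ≡ n * sumFin n G
    sumGrid-column G = trans (sumFin-cong n (λ x → sumFin-const n (G x))) (sym (*-distribˡ-sumFin n n G))

    sumGrid-transpose : (F : Fin n → Fin n → ℕ) → sumGrid F ≡ sumGrid (λ x y → F y x)
    sumGrid-transpose F = sumFin-comm n n F

    sumGrid-sumFin-comm : ∀ m (G : Fin n → Fin n → Fin m → ℕ) →
      sumGrid (λ x y → sumFin m (G x y)) ≡ sumFin m (λ c → sumGrid (λ x y → G x y c))
    sumGrid-sumFin-comm m G = trans (sumFin-cong n (λ x → sumFin-comm n m (G x))) (sumFin-comm n m _)

module Indicators where

  open Sums
  open import Data.Nat using (ℕ; zero; suc; _+_; _*_; _≤_; z≤n; s≤s)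
  open import Data.Nat.Properties hiding (suc-injective; _≟_)
  open import Data.Fin using (Fin; zero; suc)
  open import Data.Fin.Properties using (_≟_; any?; suc-injective)
  open import Data.Bool using (true; false; not; _∧_)
  open import Data.Empty using (⊥-elim)
  open import Data.Product using (_,_)
  open import Data.Sum using (_⊎_; [_,_]′)
  open import Function using (_∘_; _⇔_; mk⇔)
  open import Level using (0ℓ)
  open import Relation.Nullary using (Dec; does; yes; no; ¬_; contradiction; ¬?; _×-dec_)
  open import Relation.Nullary.Decidable using (⌊_⌋; does-⇔; dec-true; dec-false; isYes≗does)
  open import Relation.Unary using (Pred; Decidable)
  open import Relation.Binary.PropositionalEquality

  -- Unlike Defs' ⌊_⌋ = isYes, does computes through ¬? and ×-dec.
  𝟙 : ∀ {A : Set} → Dec A → ℕ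
  𝟙 a? = ind (does a?)

  𝟙-yes : ∀ {A} {a? : Dec A} → A → 𝟙 a? ≡ 1
  𝟙-yes {a? = a?} a rewrite dec-true a? a = refl

  𝟙-no : ∀ {A} {a? : Dec A} → ¬ A → 𝟙 a? ≡ 0
  𝟙-no {a? = a?} ¬a rewrite dec-false a? ¬a = refl

  ind≤1 : ∀ b → ind b ≤ 1
  ind≤1 true  = ≤-refl
  ind≤1 false = z≤n

  𝟙≤1 : ∀ {A} (a? : Dec A) → 𝟙 a? ≤ 1
  𝟙≤1 a? = ind≤1 (does a?)

  𝟙-elim : ∀ {A} (a? : Dec A) (P : ℕ → Set) → (A → P 1) → (¬ A → P 0) → P (𝟙 a?)
  𝟙-elim (yes a)  P P1 P0 = P1 a
  𝟙-elim (no ¬a) P P1 P0 = P0 ¬a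

  𝟙-mono : ∀ {A B} {a? : Dec A} {b? : Dec B} → (A → B) → 𝟙 a? ≤ 𝟙 b?
  𝟙-mono {a? = a?} {b?} A→B with a? | b?
  ... | no _  | _     = z≤n
  ... | yes _ | yes _ = ≤-refl
  ... | yes a | no ¬b = contradiction (A→B a) ¬b

  𝟙-cong : ∀ {A B} {a? : Dec A} {b? : Dec B} → A ⇔ B → 𝟙 a? ≡ 𝟙 b?
  𝟙-cong {a? = a?} {b?} A⇔B = cong ind (does-⇔ A⇔B a? b?)

  𝟙-× : ∀ {A B} (a? : Dec A) (b? : Dec B) → 𝟙 (a? ×-dec b?) ≡ 𝟙 a? * 𝟙 b?
  𝟙-× (yes _) b? = sym (+-identityʳ _)
  𝟙-× (no _)  b? = refl

  𝟙-disjoint : ∀ {A B} {a? : Dec A} {b? : Dec B} → (A → ¬ B) → 𝟙 a? + 𝟙 b? ≤ 1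
  𝟙-disjoint {a? = a?} {b?} disjoint with a? | b?
  ... | yes a | yes b = contradiction b (disjoint a)
  ... | yes _ | no _  = ≤-refl
  ... | no _  | b?′   = 𝟙≤1 b?′

  𝟙-cover : ∀ {A B C} {a? : Dec A} {b? : Dec B} {c? : Dec C} →
    (A → B ⊎ C) → 𝟙 a? ≤ 𝟙 b? + 𝟙 c?
  𝟙-cover {a? = a?} {b?} {c?} cover with a? | b? | c?
  ... | no _  | _     | _     = z≤n
  ... | yes _ | yes _ | _     = s≤s z≤n
  ... | yes _ | no _  | yes _ = ≤-refl
  ... | yes a | no ¬b | no ¬c = ⊥-elim ([ ¬b , ¬c ]′ (cover a))

  ind-not-⌊⌋ : ∀ {A} (a? : Dec A) → ind (not ⌊ a? ⌋) ≡ 𝟙 (¬? a?)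
  ind-not-⌊⌋ a? = cong (ind ∘ not) (isYes≗does a?)

  ind-⌊⌋-valid : ∀ {A B C} (a? : Dec A) (b? : Dec B) (c? : Dec C) →
    ind (not ⌊ a? ⌋ ∧ not ⌊ b? ⌋ ∧ ⌊ c? ⌋) ≡ 𝟙 (¬? a? ×-dec ¬? b? ×-dec c?)
  ind-⌊⌋-valid a? b? c? rewrite isYes≗does a? | isYes≗does b? | isYes≗does c? = refl

  count : ∀ {n} {P : Pred (Fin n) 0ℓ} → Decidable P → ℕ
  count {n} P? = sumFin n (λ i → 𝟙 (P? i))

  module _ {n} {P : Pred (Fin n) 0ℓ} (P? : Decidable P) where

    count≤n : count P? ≤ n
    count≤n = ≤-trans (sumFin-mono-≤ n (λ i → 𝟙≤1 (P? i)))
                      (≤-reflexive (trans (sumFin-const n 1) (*-identityʳ n)))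

    count-none : (∀ i → ¬ P i) → count P? ≡ 0
    count-none ¬P = trans (sumFin-cong n (λ i → 𝟙-no {a? = P? i} (¬P i))) (sumFin-zero n)

    count-+-count-¬ : count P? + count (¬? ∘ P?) ≡ n
    count-+-count-¬ = begin
      count P? + count (¬? ∘ P?)                 ≡⟨ sumFin-distrib-+ n _ _ ⟨
      sumFin n (λ i → 𝟙 (P? i) + 𝟙 (¬? (P? i))) ≡⟨ sumFin-cong n (λ i → excluded-middle (P? i)) ⟩
      sumFin n (λ _ → 1)                         ≡⟨ sumFin-const n 1 ⟩
      n * 1                                      ≡⟨ *-identityʳ n ⟩
      n                                          ∎
      where
      open ≡-Reasoning
      excluded-middle : ∀ {A} (a? : Dec A) → 𝟙 a? + 𝟙 (¬? a?) ≡ 1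
      excluded-middle (yes _) = refl
      excluded-middle (no _)  = refl

  count-≤1 : ∀ {n} {P : Pred (Fin n) 0ℓ} (P? : Decidable P) →
    (∀ {i j} → P i → P j → i ≡ j) → count P? ≤ 1
  count-≤1 {zero}  P? unique = z≤n
  count-≤1 {suc n} P? unique with P? zero
  ... | yes p = ≤-reflexive (cong suc (count-none (P? ∘ suc) (λ i pᵢ → 0≢suc (unique p pᵢ))))
    where
    0≢suc : ∀ {i : Fin n} → zero ≢ suc i
    0≢suc ()
  ... | no _  = count-≤1 (P? ∘ suc) (λ pᵢ pⱼ → suc-injective (unique pᵢ pⱼ))

  sumFin-select : ∀ n (i : Fin n) (F : Fin n → ℕ) → sumFin n (λ j → 𝟙 (i ≟ j) * F j) ≡ F i
  sumFin-select (suc n) zero    F = trans (cong₂ _+_ (+-identityʳ (F zero)) (sumFin-zero n)) (+-identityʳ _)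
  sumFin-select (suc n) (suc i) F = sumFin-select n i (F ∘ suc)

  𝟙-≟-sym : ∀ {n} (i j : Fin n) → 𝟙 (i ≟ j) ≡ 𝟙 (j ≟ i)
  𝟙-≟-sym i j = 𝟙-cong {a? = i ≟ j} {b? = j ≟ i} (mk⇔ sym sym)

  sumFin-select′ : ∀ n (i : Fin n) (F : Fin n → ℕ) → sumFin n (λ j → F j * 𝟙 (j ≟ i)) ≡ F i
  sumFin-select′ n i F =
    trans (sumFin-cong n (λ j → trans (*-comm (F j) _) (cong (_* F j) (𝟙-≟-sym j i)))) (sumFin-select n i F)

  count-≡ : ∀ n (i : Fin n) → count (λ j → j ≟ i) ≡ 1
  count-≡ n i = trans (sumFin-cong n (λ j → sym (*-identityˡ (𝟙 (j ≟ i))))) (sumFin-select′ n i (λ _ → 1))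

  count-remove : ∀ {n} {P : Pred (Fin n) 0ℓ} (P? : Decidable P) (i : Fin n) →
    count P? ≡ 𝟙 (P? i) + count (λ j → ¬? (i ≟ j) ×-dec P? j)
  count-remove {n} P? i = begin
    count P?                                                           ≡⟨ sumFin-cong n split ⟩
    sumFin n (λ j → 𝟙 (i ≟ j) * 𝟙 (P? j) + 𝟙 (¬? (i ≟ j) ×-dec P? j))
      ≡⟨ sumFin-distrib-+ n (λ j → 𝟙 (i ≟ j) * 𝟙 (P? j)) (λ j → 𝟙 (¬? (i ≟ j) ×-dec P? j)) ⟩
    sumFin n (λ j → 𝟙 (i ≟ j) * 𝟙 (P? j)) + count (λ j → ¬? (i ≟ j) ×-dec P? j)
      ≡⟨ cong (_+ count (λ j → ¬? (i ≟ j) ×-dec P? j)) (sumFin-select n i (𝟙 ∘ P?)) ⟩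
    𝟙 (P? i) + count (λ j → ¬? (i ≟ j) ×-dec P? j)                     ∎
    where
    open ≡-Reasoning
    split : ∀ j → 𝟙 (P? j) ≡ 𝟙 (i ≟ j) * 𝟙 (P? j) + 𝟙 (¬? (i ≟ j) ×-dec P? j)
    split j with i ≟ j
    ... | yes _ = sym (trans (+-identityʳ _) (+-identityʳ _))
    ... | no _  = refl

  count-fibres : ∀ {n m} {P : Pred (Fin n) 0ℓ} (P? : Decidable P) (g : Fin n → Fin m) →
    count P? ≡ sumFin m (λ c → count (λ i → P? i ×-dec g i ≟ c))
  count-fibres {n} {m} P? g = trans (sumFin-cong n fibre-sum) (sumFin-comm n m _)
    where
    fibre-sum : ∀ i → 𝟙 (P? i) ≡ sumFin m (λ c → 𝟙 (P? i ×-dec g i ≟ c))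
    fibre-sum i = sym (trans (sumFin-cong m (λ c → trans (𝟙-× (P? i) (g i ≟ c)) (*-comm (𝟙 (P? i)) _)))
                             (sumFin-select m (g i) (λ _ → 𝟙 (P? i))))

  count-images : ∀ {n m} {P Q : Pred (Fin n) 0ℓ} (P? : Decidable P) (Q? : Decidable Q)
    (g h : Fin n → Fin m) →
    (∀ {i j} → P i → P j → g i ≡ g j → i ≡ j) →
    (∀ {i j} → Q i → Q j → h i ≡ h j → i ≡ j) →
    (∀ {i j} → P i → Q j → g i ≢ h j) →
    count P? + count Q? ≤ m
  count-images {m = m} P? Q? g h g-inj h-inj g≢h = begin
    count P? + count Q?                          ≡⟨ cong₂ _+_ (count-fibres P? g) (count-fibres Q? h) ⟩
    sumFin m gFibre + sumFin m hFibre            ≡⟨ sumFin-distrib-+ m gFibre hFibre ⟨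
    sumFin m (λ c → gFibre c + hFibre c)         ≤⟨ sumFin-mono-≤ m fibres≤1 ⟩
    sumFin m (λ _ → 1)                           ≡⟨ trans (sumFin-const m 1) (*-identityʳ m) ⟩
    m                                            ∎
    where
    open ≤-Reasoning
    gFibre hFibre : Fin m → ℕ
    gFibre c = count (λ i → P? i ×-dec g i ≟ c)
    hFibre c = count (λ i → Q? i ×-dec h i ≟ c)
    fibres≤1 : ∀ c → gFibre c + hFibre c ≤ 1
    fibres≤1 c with any? (λ i → P? i ×-dec g i ≟ c)
    ... | yes (i , pᵢ , gᵢ≡c) = begin
      gFibre c + hFibre c
        ≡⟨ cong (gFibre c +_) (count-none (λ j → Q? j ×-dec h j ≟ c)
                                (λ j (qⱼ , hⱼ≡c) → g≢h pᵢ qⱼ (trans gᵢ≡c (sym hⱼ≡c)))) ⟩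
      gFibre c + 0
        ≡⟨ +-identityʳ _ ⟩
      gFibre c
        ≤⟨ count-≤1 (λ j → P? j ×-dec g j ≟ c) (λ (pᵢ , gᵢ≡c) (pⱼ , gⱼ≡c) → g-inj pᵢ pⱼ (trans gᵢ≡c (sym gⱼ≡c))) ⟩
      1 ∎
    ... | no ∄ = begin
      gFibre c + hFibre c
        ≡⟨ cong (_+ hFibre c) (count-none (λ j → P? j ×-dec g j ≟ c) (λ i pᵢ → ∄ (i , pᵢ))) ⟩
      hFibre c
        ≤⟨ count-≤1 (λ j → Q? j ×-dec h j ≟ c) (λ (qᵢ , hᵢ≡c) (qⱼ , hⱼ≡c) → h-inj qᵢ qⱼ (trans hᵢ≡c (sym hⱼ≡c))) ⟩
      1 ∎

module PartialInjections where

  open import Data.Nat using (ℕ; zero; suc; _≤_; _<_)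
  open import Data.Nat.Properties using (<⇒≤; <-irrefl; m<1+n⇒m<n∨m≡n; ≤-refl)
  open import Data.Fin using (Fin; toℕ; fromℕ<)
  open import Data.Fin.Properties using (_≟_; toℕ-fromℕ<; toℕ-injective; toℕ<n)
  open import Data.Fin.Permutation using (Permutation′; _⟨$⟩ʳ_; _⟨$⟩ˡ_; transpose; _∘ₚ_; inverseʳ; id)
  import Data.Fin.Permutation.Components as Transposition
  open import Data.Product using (∃; _,_)
  open import Data.Sum using (inj₁; inj₂)
  open import Level using (0ℓ)
  open import Relation.Nullary using (yes; no; contradiction)
  open import Relation.Nullary.Decidable using (dec-true; dec-false)
  open import Relation.Unary using (Pred; Decidable)
  open import Relation.Binary.PropositionalEquality

  transpose-left : ∀ {n} (i j : Fin n) → Transposition.transpose i j i ≡ j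
  transpose-left i j rewrite dec-true (i ≟ i) refl = refl

  transpose-other : ∀ {n} (i j k : Fin n) → k ≢ i → k ≢ j → Transposition.transpose i j k ≡ k
  transpose-other i j k k≢i k≢j rewrite dec-false (k ≟ i) k≢i | dec-false (k ≟ j) k≢j = refl

  module _ {n} {P : Pred (Fin n) 0ℓ} (P? : Decidable P) (h : Fin n → Fin n)
           (h-inj : ∀ {i j} → P i → P j → h i ≡ h j → i ≡ j) where

    private
      AgreesBelow : ℕ → Permutation′ n → Set
      AgreesBelow m σ = ∀ i → toℕ i < m → P i → σ ⟨$⟩ʳ i ≡ h i

      agreesBelow : ∀ m → m ≤ n → ∃ (AgreesBelow m)
      agreesBelow zero    _   = id , λ _ ()
      agreesBelow (suc m) m<n with agreesBelow m (<⇒≤ m<n) | P? (fromℕ< m<n)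
      ... | σ , σ-agrees | no ¬pₘ = σ , agrees
        where
        agrees : AgreesBelow (suc m) σ
        agrees i i<1+m pᵢ with m<1+n⇒m<n∨m≡n i<1+m
        ... | inj₁ i<m = σ-agrees i i<m pᵢ
        ... | inj₂ i≡m = contradiction (subst P (toℕ-injective (trans i≡m (sym (toℕ-fromℕ< m<n)))) pᵢ) ¬pₘ
      ... | σ , σ-agrees | yes pₘ = transpose iₘ z ∘ₚ σ , agrees
        where
        iₘ z : Fin n
        iₘ = fromℕ< m<n
        z  = σ ⟨$⟩ˡ h iₘ
        below≢iₘ : ∀ {i} → toℕ i < m → i ≢ iₘ
        below≢iₘ i<m refl = <-irrefl (toℕ-fromℕ< m<n) i<m
        agrees : AgreesBelow (suc m) (transpose iₘ z ∘ₚ σ)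
        agrees i i<1+m pᵢ with m<1+n⇒m<n∨m≡n i<1+m
        ... | inj₂ i≡m rewrite toℕ-injective (trans i≡m (sym (toℕ-fromℕ< m<n))) =
          trans (cong (σ ⟨$⟩ʳ_) (transpose-left iₘ z)) (inverseʳ σ)
        ... | inj₁ i<m with i ≟ z
        ... | no i≢z = trans (cong (σ ⟨$⟩ʳ_) (transpose-other iₘ z i (below≢iₘ i<m) i≢z)) (σ-agrees i i<m pᵢ)
        ... | yes refl = contradiction (h-inj pᵢ pₘ (trans (sym (σ-agrees i i<m pᵢ)) (inverseʳ σ))) (below≢iₘ i<m)

    extend-partial-injection : ∃ λ (σ : Permutation′ n) → ∀ {i} → P i → σ ⟨$⟩ʳ i ≡ h i
    extend-partial-injection with σ , σ-agrees ← agreesBelow n ≤-refl = σ , λ {i} → σ-agrees i (toℕ<n i)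

module Thresholds where

  open import Data.Nat using (ℕ; zero; suc; _+_; _*_; _≤_; _<_; _<?_)
  open import Data.Nat.Properties
  open import Data.Nat.Tactic.RingSolver using (solve-∀)
  open import Data.Empty using (⊥)
  open import Data.Product using (_×_; _,_)
  open import Relation.Nullary using (Dec; ¬_; _×-dec_; yes; no)
  open import Relation.Binary.PropositionalEquality

  Large Small : ℕ → ℕ → Set
  Large k a = 7 * k < 8 * (a + 1)
  Small k r = 8 * r < k

  StripeLike : (k along across r : ℕ) → Set
  StripeLike k along across r = across ≡ 0 × Large k along × Small k r

  stripeLike? : ∀ k along across r → Dec (StripeLike k along across r)
  stripeLike? k along across r = across Data.Nat.≟ 0 ×-dec 7 * k <? 8 * (along + 1) ×-dec 8 * r <? k

  module _ {k} (k≥3 : 3 ≤ k) where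

    16≤6k : 16 ≤ 6 * k
    16≤6k = ≤-trans (m≤m+n 16 2) (*-monoʳ-≤ 6 k≥3)

    ¬large≤1+small : ∀ {a r} → Large k a → a ≤ 1 + r → Small k r → ⊥
    ¬large≤1+small {a} {r} large a≤1+r small = <-irrefl refl (begin-strict
      7 * k           <⟨ large ⟩
      8 * (a + 1)     ≤⟨ *-monoʳ-≤ 8 (+-monoˡ-≤ 1 a≤1+r) ⟩
      8 * (1 + r + 1) ≡⟨ expand r ⟩
      16 + 8 * r      <⟨ +-monoʳ-< 16 small ⟩
      16 + k          ≤⟨ +-monoˡ-≤ k 16≤6k ⟩
      6 * k + k       ≡⟨ +-comm (6 * k) k ⟩
      7 * k           ∎)
      where
      open ≤-Reasoning
      expand : ∀ r → 8 * (1 + r + 1) ≡ 16 + 8 * r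
      expand = solve-∀

    ¬large+large≤k : ∀ {a b} → Large k a → Large k b → a + b ≤ k → ⊥
    ¬large+large≤k {a} {b} large-a large-b a+b≤k = <-irrefl refl (begin-strict
      7 * k + 7 * k             <⟨ +-mono-< large-a large-b ⟩
      8 * (a + 1) + 8 * (b + 1) ≡⟨ expand a b ⟩
      16 + 8 * (a + b)          ≤⟨ +-monoʳ-≤ 16 (*-monoʳ-≤ 8 a+b≤k) ⟩
      16 + 8 * k                ≤⟨ +-monoˡ-≤ (8 * k) 16≤6k ⟩
      6 * k + 8 * k             ≡⟨ regroup k ⟩
      7 * k + 7 * k             ∎)
      where
      open ≤-Reasoning
      expand : ∀ a b → 8 * (a + 1) + 8 * (b + 1) ≡ 16 + 8 * (a + b)
      expand = solve-∀
      regroup : ∀ k → 6 * k + 8 * k ≡ 7 * k + 7 * k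
      regroup = solve-∀

    ¬large-0 : ¬ Large k 0
    ¬large-0 large = <⇒≱ large (≤-trans (m≤m+n 8 13) (*-monoʳ-≤ 7 k≥3))

    1+a+b≤k+ab : ∀ {a b} → 1 + a ≤ k → 1 + b ≤ k → 1 + a + b ≤ k + a * b
    1+a+b≤k+ab {zero}  {b} _   b<k = ≤-trans b<k (m≤m+n k 0)
    1+a+b≤k+ab {suc a} {b} a<k _   = ≤-trans (+-monoˡ-≤ b a<k) (+-monoʳ-≤ k (m≤m+n b (a * b)))

    one-line-price : ∀ c r → ¬ Large k c → k + 8 * (1 + c) ≤ 8 * (r + k)
    one-line-price c r ¬large = begin
      k + 8 * (1 + c) ≡⟨ cong (λ t → k + 8 * t) (+-comm 1 c) ⟩
      k + 8 * (c + 1) ≤⟨ +-monoʳ-≤ k (≮⇒≥ ¬large) ⟩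
      k + 7 * k       ≤⟨ m≤n+m (8 * k) (8 * r) ⟩
      8 * r + 8 * k   ≡⟨ *-distribˡ-+ 8 r k ⟨
      8 * (r + k)     ∎
      where open ≤-Reasoning

    two-line-price : ∀ a b r → k + 8 * (1 + suc a + suc b) ≤ 8 * (r + (k + suc a * suc b))
    two-line-price a b r = begin
      k + 8 * (1 + suc a + suc b)               ≡⟨ expand k a b ⟩
      16 + k + 8 * (a + b + 1)                  ≤⟨ +-monoˡ-≤ (8 * (a + b + 1)) (+-monoˡ-≤ k 16≤6k) ⟩
      6 * k + k + 8 * (a + b + 1)               ≤⟨ +-monoˡ-≤ (8 * (a + b + 1)) 7k≤ ⟩
      8 * r + (8 * k + 8 * (a * b)) + 8 * (a + b + 1) ≡⟨ collect r k a b ⟩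
      8 * (r + (k + suc a * suc b))             ∎
      where
      open ≤-Reasoning
      7k≤ : 6 * k + k ≤ 8 * r + (8 * k + 8 * (a * b))
      7k≤ = ≤-trans (≤-reflexive (+-comm (6 * k) k)) (≤-trans (*-monoˡ-≤ k (n≤1+n 7))
              (≤-trans (m≤m+n (8 * k) (8 * (a * b))) (m≤n+m _ (8 * r))))
      expand : ∀ k a b → k + 8 * (1 + suc a + suc b) ≡ 16 + k + 8 * (a + b + 1)
      expand = solve-∀
      collect : ∀ r k a b → 8 * r + (8 * k + 8 * (a * b)) + 8 * (a + b + 1) ≡ 8 * (r + (k + suc a * suc b))
      collect = solve-∀

    irregular-price : ∀ a b r → 1 + a ≤ k → 1 + b ≤ k → ¬ StripeLike k a b r → ¬ StripeLike k b a r →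
      k + 8 * (1 + a + b) ≤ 8 * (r + (k + a * b))
    irregular-price a b r a<k b<k ¬h ¬v with 8 * r <? k
    ... | no ¬small = begin
      k + 8 * (1 + a + b)     ≤⟨ +-mono-≤ (≮⇒≥ ¬small) (*-monoʳ-≤ 8 (1+a+b≤k+ab a<k b<k)) ⟩
      8 * r + 8 * (k + a * b) ≡⟨ *-distribˡ-+ 8 r _ ⟨
      8 * (r + (k + a * b))   ∎
      where open ≤-Reasoning
    ... | yes small = small-price a b ¬h ¬v
      where
      small-price : ∀ a b → ¬ StripeLike k a b r → ¬ StripeLike k b a r →
        k + 8 * (1 + a + b) ≤ 8 * (r + (k + a * b))
      small-price zero b _ ¬v =
        subst (λ t → k + 8 * (1 + b) ≤ 8 * (r + t)) (sym (+-identityʳ k))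
              (one-line-price b r (λ large → ¬v (refl , large , small)))
      small-price (suc a) zero ¬h _ =
        subst₂ (λ s t → k + 8 * s ≤ 8 * (r + t))
               (sym (+-identityʳ (2 + a))) (sym (trans (cong (k +_) (*-zeroʳ a)) (+-identityʳ k)))
               (one-line-price (suc a) r (λ large → ¬h (refl , large , small)))
      small-price (suc a) (suc b) _ _ = two-line-price a b r

  price-balance : ∀ {c m R K A} → c + 8 * m ≤ 8 * (R + (K + A)) → K ≤ m + R → A ≤ R → c ≤ 24 * R
  price-balance {c} {m} {R} {K} {A} price K≤m+R A≤R = +-cancelʳ-≤ (8 * m) c (24 * R) (begin
    c + 8 * m               ≤⟨ price ⟩
    8 * (R + (K + A))       ≤⟨ *-monoʳ-≤ 8 (+-monoʳ-≤ R (+-mono-≤ K≤m+R A≤R)) ⟩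
    8 * (R + (m + R + R))   ≡⟨ regroup R m ⟩
    24 * R + 8 * m          ∎)
    where
    open ≤-Reasoning
    regroup : ∀ R m → 8 * (R + (m + R + R)) ≡ 24 * R + 8 * m
    regroup = solve-∀

  stripe-balance : ∀ {k h v a C D} → h + a ≡ k → h + v ≤ k → v ≤ h →
    k * a ≤ C + v * a → D ≤ k * a + C + k * v → D ≤ 5 * C
  stripe-balance {k} {h} {v} {a} {C} {D} h+a≡k h+v≤k v≤h ka≤C+va D≤ = begin
    D                 ≤⟨ D≤ ⟩
    k * a + C + k * v ≤⟨ +-monoʳ-≤ (k * a + C) (*-monoʳ-≤ k v≤a) ⟩
    k * a + C + k * a ≤⟨ +-mono-≤ (+-monoˡ-≤ C ka≤2C) ka≤2C ⟩
    2 * C + C + 2 * C ≡⟨ regroup C ⟩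
    5 * C             ∎
    where
    open ≤-Reasoning
    regroup : ∀ C → 2 * C + C + 2 * C ≡ 5 * C
    regroup = solve-∀
    v≤a : v ≤ a
    v≤a = +-cancelˡ-≤ h v a (subst (h + v ≤_) (sym h+a≡k) h+v≤k)
    2v≤k : 2 * v ≤ k
    2v≤k = begin
      2 * v ≡⟨ cong (v +_) (+-identityʳ v) ⟩
      v + v ≤⟨ +-monoʳ-≤ v v≤h ⟩
      v + h ≡⟨ +-comm v h ⟩
      h + v ≤⟨ h+v≤k ⟩
      k     ∎
    ka≤2C : k * a ≤ 2 * C
    ka≤2C = +-cancelʳ-≤ (k * a) (k * a) (2 * C) (begin
      k * a + k * a             ≤⟨ +-mono-≤ ka≤C+va ka≤C+va ⟩
      (C + v * a) + (C + v * a) ≡⟨ regroup′ C v a ⟩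
      2 * C + 2 * v * a         ≤⟨ +-monoʳ-≤ (2 * C) (*-monoˡ-≤ a 2v≤k) ⟩
      2 * C + k * a             ∎)
      where
      regroup′ : ∀ C v a → (C + v * a) + (C + v * a) ≡ 2 * C + 2 * v * a
      regroup′ = solve-∀

module Colourings where

  open Sums
  open Indicators
  open PartialInjections
  open Thresholds
  open import Data.Nat using (ℕ; zero; suc; _+_; _*_; _≤_; _≤?_)
  open import Data.Nat.Properties hiding (suc-injective; _≟_)
  open import Data.Nat.Tactic.RingSolver using (solve-∀)
  open import Data.Fin using (Fin; zero; suc)
  open import Data.Fin.Properties using (_≟_; any?)
  open import Data.Fin.Permutation using (Permutation′; _⟨$⟩ʳ_)
  open import Data.Bool using (true; not; _∧_)
  open import Data.Empty using (⊥-elim)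
  open import Data.Product using (∃; _×_; _,_; proj₂)
  open import Data.Sum using (_⊎_; inj₁; inj₂)
  open import Function using (_∘_; id; mk⇔)
  open import Relation.Nullary using (Dec; ¬_; ¬?; _×-dec_; _⊎-dec_; yes; no; contradiction)
  open import Relation.Nullary.Decidable using (⌊_⌋)
  open import Relation.Binary.PropositionalEquality

  module Statistics {k} (f : Coloring k) where

    Rejects : Fin k → Fin k → Fin k → Fin k → Set
    Rejects x₁ y₁ x₂ y₂ = x₁ ≢ x₂ × y₁ ≢ y₂ × f x₁ y₁ ≡ f x₂ y₂

    rejects? : ∀ x₁ y₁ x₂ y₂ → Dec (Rejects x₁ y₁ x₂ y₂)
    rejects? x₁ y₁ x₂ y₂ = ¬? (x₁ ≟ x₂) ×-dec ¬? (y₁ ≟ y₂) ×-dec f x₁ y₁ ≟ f x₂ y₂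

    rowMate? : ∀ x y x₂ → Dec (x ≢ x₂ × f x y ≡ f x₂ y)
    rowMate? x y x₂ = ¬? (x ≟ x₂) ×-dec f x y ≟ f x₂ y

    colMate? : ∀ x y y₂ → Dec (y ≢ y₂ × f x y ≡ f x y₂)
    colMate? x y y₂ = ¬? (y ≟ y₂) ×-dec f x y ≟ f x y₂

    rowMates colMates rej lineMates : Fin k → Fin k → ℕ
    rowMates x y = count (rowMate? x y)
    colMates x y = count (colMate? x y)
    rej x y = sumGrid (λ x₂ y₂ → 𝟙 (rejects? x y x₂ y₂))
    lineMates x y = 1 + rowMates x y + colMates x y

    Rej : ℕ
    Rej = sumGrid rej

    classSize : Fin k → ℕ
    classSize c = sumFin k λ x → count (λ y → c ≟ f x y)

    count-rowColour : ∀ x y → count (λ x₂ → f x y ≟ f x₂ y) ≡ 1 + rowMates x y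
    count-rowColour x y = trans (count-remove (λ x₂ → f x y ≟ f x₂ y) x)
                                (cong (_+ rowMates x y) (𝟙-yes {a? = f x y ≟ f x y} refl))

    rowMates<k : ∀ x y → 1 + rowMates x y ≤ k
    rowMates<k x y = subst (_≤ k) (count-rowColour x y) (count≤n (λ x₂ → f x y ≟ f x₂ y))

    classSize-colour : ∀ x y → classSize (f x y) ≡ lineMates x y + rej x y
    classSize-colour x y = begin
      sumFin k (λ x₂ → count (λ y₂ → c ≟ f x₂ y₂))
        ≡⟨ sumFin-cong k (λ x₂ → count-remove (λ y₂ → c ≟ f x₂ y₂) y) ⟩
      sumFin k (λ x₂ → 𝟙 (c ≟ f x₂ y) + count (λ y₂ → offRow y₂ ×-dec c ≟ f x₂ y₂))
        ≡⟨ sumFin-distrib-+ k _ _ ⟩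
      count (λ x₂ → c ≟ f x₂ y) + sumFin k (λ x₂ → count (λ y₂ → offRow y₂ ×-dec c ≟ f x₂ y₂))
        ≡⟨ cong₂ _+_ (count-rowColour x y) (sumFin-comm k k _) ⟩
      1 + rowMates x y + sumFin k (λ y₂ → count (λ x₂ → offRow y₂ ×-dec c ≟ f x₂ y₂))
        ≡⟨ cong (1 + rowMates x y +_)
                (sumFin-cong k (λ y₂ → count-remove (λ x₂ → offRow y₂ ×-dec c ≟ f x₂ y₂) x)) ⟩
      1 + rowMates x y + sumFin k (λ y₂ → 𝟙 (offRow y₂ ×-dec c ≟ f x y₂)
                                         + count (λ x₂ → ¬? (x ≟ x₂) ×-dec offRow y₂ ×-dec c ≟ f x₂ y₂))
        ≡⟨ cong (1 + rowMates x y +_)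
                (trans (sumFin-distrib-+ k _ _) (cong (colMates x y +_) (sumFin-comm k k _))) ⟩
      1 + rowMates x y + (colMates x y + rej x y)
        ≡⟨ +-assoc (1 + rowMates x y) (colMates x y) (rej x y) ⟨
      lineMates x y + rej x y ∎
      where
      open ≡-Reasoning
      c : Fin k
      c = f x y
      offRow : ∀ y₂ → Dec (y ≢ y₂)
      offRow y₂ = ¬? (y ≟ y₂)

    sum-classSize : sumFin k classSize ≡ k * k
    sum-classSize = begin
      sumFin k (λ c → sumGrid (λ x y → 𝟙 (c ≟ f x y)))   ≡⟨ sumGrid-sumFin-comm {k} k (λ x y c → 𝟙 (c ≟ f x y)) ⟨
      sumGrid (λ x y → count (λ c → c ≟ f x y))          ≡⟨ sumGrid-cong (λ x y → count-≡ k (f x y)) ⟩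
      sumGrid {k} (λ _ _ → 1)                            ≡⟨ sumGrid-const {k} 1 ⟩
      k * (k * 1)                                        ≡⟨ cong (k *_) (*-identityʳ k) ⟩
      k * k                                              ∎
      where open ≡-Reasoning

    sum-classSize-colour : sumGrid (λ x y → classSize (f x y)) ≡ sumFin k (λ c → classSize c * classSize c)
    sum-classSize-colour = begin
      sumGrid (λ x y → classSize (f x y))
        ≡⟨ sumGrid-cong (λ x y → sym (sumFin-select′ k (f x y) classSize)) ⟩
      sumGrid (λ x y → sumFin k (λ c → classSize c * 𝟙 (c ≟ f x y)))
        ≡⟨ sumGrid-sumFin-comm {k} k (λ x y c → classSize c * 𝟙 (c ≟ f x y)) ⟩
      sumFin k (λ c → sumGrid (λ x y → classSize c * 𝟙 (c ≟ f x y)))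
        ≡⟨ sumFin-cong k (λ c → *-distribˡ-sumGrid (classSize c) (λ x y → 𝟙 (c ≟ f x y))) ⟨
      sumFin k (λ c → classSize c * classSize c) ∎
      where open ≡-Reasoning

    k³≤sum-lineMates+Rej : k * (k * k) ≤ sumGrid lineMates + Rej
    k³≤sum-lineMates+Rej = +-cancelˡ-≤ (k * (k * k)) _ _ (begin
      k * (k * k) + k * (k * k)                      ≡⟨ double k (k * k) ⟩
      2 * k * (k * k)                                ≡⟨ cong (2 * k *_) sum-classSize ⟨
      2 * k * sumFin k classSize                     ≤⟨ sumFin-squares k k classSize ⟩
      k * (k * k) + sumFin k (λ c → classSize c * classSize c)
        ≡⟨ cong (k * (k * k) +_) (trans (sym sum-classSize-colour)
             (trans (sumGrid-cong classSize-colour) (sumGrid-distrib-+ lineMates rej))) ⟩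
      k * (k * k) + (sumGrid lineMates + Rej)        ∎)
      where
      open ≤-Reasoning
      double : ∀ a b → a * b + a * b ≡ 2 * a * b
      double = solve-∀

    sum-rowMates*colMates≤Rej : sumGrid (λ x y → rowMates x y * colMates x y) ≤ Rej
    sum-rowMates*colMates≤Rej = begin
      sumGrid (λ x y → rowMates x y * colMates x y)
        ≡⟨ sumGrid-cong (λ x y → sumFin-product k k (𝟙 ∘ rowMate? x y) (𝟙 ∘ colMate? x y)) ⟨
      sumGrid (λ x y → sumGrid (λ x₂ y₂ → 𝟙 (rowMate? x y x₂) * 𝟙 (colMate? x y y₂)))
        ≤⟨ sumGrid-mono-≤ (λ x y → sumGrid-mono-≤ (λ x₂ y₂ → mates-reject x y x₂ y₂)) ⟩
      sumGrid (λ x y → sumGrid (λ x₂ y₂ → 𝟙 (rejects? x₂ y x y₂)))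
        ≡⟨ sumGrid-sumFin-comm {k} k (λ x y x₂ → sumFin k (λ y₂ → 𝟙 (rejects? x₂ y x y₂))) ⟩
      sumFin k (λ x₂ → sumGrid (λ x y → sumFin k (λ y₂ → 𝟙 (rejects? x₂ y x y₂))))
        ≡⟨ sumFin-cong k (λ x₂ → sumGrid-transpose (λ x y → sumFin k (λ y₂ → 𝟙 (rejects? x₂ y x y₂)))) ⟩
      Rej ∎
      where
      open ≤-Reasoning
      mates-reject : ∀ x y x₂ y₂ → 𝟙 (rowMate? x y x₂) * 𝟙 (colMate? x y y₂) ≤ 𝟙 (rejects? x₂ y x y₂)
      mates-reject x y x₂ y₂ = ≤-trans (≤-reflexive (sym (𝟙-× (rowMate? x y x₂) (colMate? x y y₂))))
        (𝟙-mono {a? = rowMate? x y x₂ ×-dec colMate? x y y₂} {b? = rejects? x₂ y x y₂}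
                (λ ((x≢x₂ , e₁) , (y≢y₂ , e₂)) → x≢x₂ ∘ sym , y≢y₂ , trans (sym e₁) e₂))

    rowMates≤1+rej : ∀ {x y x′ y′} → f x y ≡ f x′ y′ → y ≢ y′ → rowMates x′ y′ ≤ 1 + rej x y
    rowMates≤1+rej {x} {y} {x′} {y′} same y≢y′ = begin
      rowMates x′ y′
        ≤⟨ sumFin-mono-≤ k (λ x₂ → 𝟙-mono {a? = rowMate? x′ y′ x₂} {b? = f x′ y′ ≟ f x₂ y′} proj₂) ⟩
      count (λ x₂ → f x′ y′ ≟ f x₂ y′)
        ≡⟨ count-remove (λ x₂ → f x′ y′ ≟ f x₂ y′) x ⟩
      𝟙 (f x′ y′ ≟ f x y′) + count (λ x₂ → ¬? (x ≟ x₂) ×-dec f x′ y′ ≟ f x₂ y′)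
        ≤⟨ +-mono-≤ (𝟙≤1 (f x′ y′ ≟ f x y′))
                    (sumFin-mono-≤ k (λ x₂ →
                      𝟙-mono {a? = ¬? (x ≟ x₂) ×-dec f x′ y′ ≟ f x₂ y′} {b? = rejects? x y x₂ y′}
                             (λ (x≢x₂ , e) → x≢x₂ , y≢y′ , trans same e))) ⟩
      1 + sumFin k (λ x₂ → 𝟙 (rejects? x y x₂ y′))
        ≤⟨ +-monoʳ-≤ 1 (sumFin-mono-≤ k (λ x₂ → term≤sumFin k (λ y₂ → 𝟙 (rejects? x y x₂ y₂)) y′)) ⟩
      1 + rej x y ∎
      where open ≤-Reasoning

    rowMates+rowMates≤k : ∀ {x x′ y} → f x y ≢ f x′ y → rowMates x y + rowMates x′ y ≤ k
    rowMates+rowMates≤k {x} {x′} {y} differ = begin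
      rowMates x y + rowMates x′ y                            ≡⟨ sumFin-distrib-+ k _ _ ⟨
      sumFin k (λ x₂ → 𝟙 (rowMate? x y x₂) + 𝟙 (rowMate? x′ y x₂))
        ≤⟨ sumFin-mono-≤ k (λ x₂ → 𝟙-disjoint {a? = rowMate? x y x₂} {b? = rowMate? x′ y x₂}
                                     (λ (_ , e) (_ , e′) → differ (trans e (sym e′)))) ⟩
      sumFin k (λ _ → 1)                                      ≡⟨ trans (sumFin-const k 1) (*-identityʳ k) ⟩
      k                                                       ∎
      where open ≤-Reasoning

  _ᵀ : ∀ {k} → Coloring k → Coloring k
  (f ᵀ) x y = f y x

  module _ {k} (f : Coloring k) where
    private
      module S = Statistics f
      module T = Statistics (f ᵀ)

    rej-transpose : ∀ x y → T.rej y x ≡ S.rej x y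
    rej-transpose x y = trans (sumGrid-transpose (λ y₂ x₂ → 𝟙 (T.rejects? y x y₂ x₂)))
      (sumGrid-cong (λ x₂ y₂ → 𝟙-cong {a? = T.rejects? y x y₂ x₂} {b? = S.rejects? x y x₂ y₂}
        (mk⇔ (λ (y≢ , x≢ , e) → x≢ , y≢ , e) (λ (x≢ , y≢ , e) → y≢ , x≢ , e))))

    Rej-transpose : T.Rej ≡ S.Rej
    Rej-transpose = trans (sumGrid-cong (λ y x → rej-transpose x y)) (sym (sumGrid-transpose S.rej))

  module Cells {k} (k≥3 : 3 ≤ k) (f : Coloring k) where
    open Statistics f

    Horizontal : Fin k → Fin k → Set
    Horizontal x y = StripeLike k (rowMates x y) (colMates x y) (rej x y)

    horizontal? : ∀ x y → Dec (Horizontal x y)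
    horizontal? x y = stripeLike? k (rowMates x y) (colMates x y) (rej x y)

    horizontal-colour⇒row : ∀ {x y x′ y′} → Horizontal x y → Horizontal x′ y′ → f x y ≡ f x′ y′ → y ≡ y′
    horizontal-colour⇒row {y = y} {y′ = y′} (_ , _ , small) (_ , large′ , _) same with y ≟ y′
    ... | yes y≡y′ = y≡y′
    ... | no y≢y′  = ⊥-elim (¬large≤1+small k≥3 large′ (rowMates≤1+rej same y≢y′) small)

    horizontal-row⇒colour : ∀ {x x′ y} → Horizontal x y → Horizontal x′ y → f x y ≡ f x′ y
    horizontal-row⇒colour {x} {x′} {y} (_ , large , _) (_ , large′ , _) with f x y ≟ f x′ y
    ... | yes same = same
    ... | no differ =
      ⊥-elim (¬large+large≤k k≥3 {rowMates x y} {rowMates x′ y} large large′ (rowMates+rowMates≤k differ))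

    HorizontalLine : Fin k → Set
    HorizontalLine y = ∃ λ x → Horizontal x y

    horizontalLine? : ∀ y → Dec (HorizontalLine y)
    horizontalLine? y = any? (λ x → horizontal? x y)

    lineColour : Fin k → Fin k
    lineColour y with horizontalLine? y
    ... | yes (x , _) = f x y
    ... | no _        = y  -- junk, never consulted

    lineColour-horizontal : ∀ {x y} → Horizontal x y → lineColour y ≡ f x y
    lineColour-horizontal {x} {y} h with horizontalLine? y
    ... | yes (x′ , h′) = horizontal-row⇒colour h′ h
    ... | no ∄          = contradiction (x , h) ∄

    lineColour-injective : ∀ {y y′} → HorizontalLine y → HorizontalLine y′ →
      lineColour y ≡ lineColour y′ → y ≡ y′
    lineColour-injective (x , h) (x′ , h′) same =
      horizontal-colour⇒row h h′ (trans (sym (lineColour-horizontal h)) (trans same (lineColour-horizontal h′)))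

  mismatches : ∀ {k} → Coloring k → Coloring k → ℕ
  mismatches f g = sumGrid (λ x y → 𝟙 (¬? (f x y ≟ g x y)))

  mismatches-transpose : ∀ {k} (f g : Coloring k) → mismatches (f ᵀ) (g ᵀ) ≡ mismatches f g
  mismatches-transpose f g = sym (sumGrid-transpose (λ x y → 𝟙 (¬? (f x y ≟ g x y))))

  module Striping {k} (k≥3 : 3 ≤ k) (f : Coloring k) where
    open Statistics f
    open Cells k≥3 f
    private
      module V = Cells k≥3 (f ᵀ)

    -- Column x of f is row x of f ᵀ: their rowMates and colMates agree definitionally, rej only up to
    -- rej-transpose.
    Vertical : Fin k → Fin k → Set
    Vertical x y = V.Horizontal y x

    vertical? : ∀ x y → Dec (Vertical x y)
    vertical? x y = V.horizontal? y x

    Irregular : Fin k → Fin k → Set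
    Irregular x y = ¬ Horizontal x y × ¬ Vertical x y

    irregular? : ∀ x y → Dec (Irregular x y)
    irregular? x y = ¬? (horizontal? x y) ×-dec ¬? (vertical? x y)

    irregulars : ℕ
    irregulars = sumGrid (λ x y → 𝟙 (irregular? x y))

    colMates<k : ∀ x y → 1 + colMates x y ≤ k
    colMates<k x y = Statistics.rowMates<k (f ᵀ) y x

    lineMates-price : ∀ x y → 8 * lineMates x y ≤ 8 * (rej x y + (k + rowMates x y * colMates x y))
    lineMates-price x y =
      *-monoʳ-≤ 8 (≤-trans (1+a+b≤k+ab k≥3 (rowMates<k x y) (colMates<k x y)) (m≤n+m _ (rej x y)))

    cell-price : ∀ x y →
      k * 𝟙 (irregular? x y) + 8 * lineMates x y ≤ 8 * (rej x y + (k + rowMates x y * colMates x y))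
    cell-price x y = 𝟙-elim (irregular? x y) (λ t → k * t + 8 * lineMates x y ≤ budget) irregular regular
      where
      budget : ℕ
      budget = 8 * (rej x y + (k + rowMates x y * colMates x y))
      irregular : Irregular x y → k * 1 + 8 * lineMates x y ≤ budget
      irregular (¬h , ¬v) = subst (λ t → t + 8 * lineMates x y ≤ budget) (sym (*-identityʳ k))
        (irregular-price k≥3 (rowMates x y) (colMates x y) (rej x y) (rowMates<k x y) (colMates<k x y)
          ¬h (¬v ∘ subst (StripeLike k (colMates x y) (rowMates x y)) (sym (rej-transpose f x y))))
      regular : ¬ Irregular x y → k * 0 + 8 * lineMates x y ≤ budget
      regular _ = subst (λ t → t + 8 * lineMates x y ≤ budget) (sym (*-zeroʳ k)) (lineMates-price x y)

    k*irregulars≤24*Rej : k * irregulars ≤ 24 * Rej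
    k*irregulars≤24*Rej = price-balance total-price k³≤sum-lineMates+Rej sum-rowMates*colMates≤Rej
      where
      open ≤-Reasoning
      rowMates*colMates : Fin k → Fin k → ℕ
      rowMates*colMates x y = rowMates x y * colMates x y
      total-price :
        k * irregulars + 8 * sumGrid lineMates ≤ 8 * (Rej + (k * (k * k) + sumGrid rowMates*colMates))
      total-price = begin
        k * irregulars + 8 * sumGrid lineMates
          ≡⟨ cong₂ _+_ (*-distribˡ-sumGrid k (λ x y → 𝟙 (irregular? x y))) (*-distribˡ-sumGrid 8 lineMates) ⟩
        sumGrid (λ x y → k * 𝟙 (irregular? x y)) + sumGrid (λ x y → 8 * lineMates x y)
          ≡⟨ sumGrid-distrib-+ (λ x y → k * 𝟙 (irregular? x y)) (λ x y → 8 * lineMates x y) ⟨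
        sumGrid (λ x y → k * 𝟙 (irregular? x y) + 8 * lineMates x y)
          ≤⟨ sumGrid-mono-≤ cell-price ⟩
        sumGrid (λ x y → 8 * (rej x y + (k + rowMates*colMates x y)))
          ≡⟨ *-distribˡ-sumGrid 8 (λ x y → rej x y + (k + rowMates*colMates x y)) ⟨
        8 * sumGrid (λ x y → rej x y + (k + rowMates*colMates x y))
          ≡⟨ cong (8 *_) (trans (sumGrid-distrib-+ rej _) (cong (Rej +_)
               (trans (sumGrid-distrib-+ (λ _ _ → k) rowMates*colMates)
                      (cong (_+ sumGrid rowMates*colMates) (sumGrid-const {k} k))))) ⟩
        8 * (Rej + (k * (k * k) + sumGrid rowMates*colMates)) ∎

    horizontal-vertical-colour : ∀ {x y x′ y′} → Horizontal x y → Vertical x′ y′ → f x y ≢ f x′ y′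
    horizontal-vertical-colour {x} {y} {x′} {y′} (noColMates , _ , small) (_ , large′ , _) same with x ≟ x′
    ... | no x≢x′ = ¬large≤1+small k≥3 large′
          (subst (λ r → colMates x′ y′ ≤ 1 + r) (rej-transpose f x y) (Statistics.rowMates≤1+rej (f ᵀ) same x≢x′))
          small
    ... | yes refl with y ≟ y′
    ...   | yes refl = ¬large-0 k≥3 (subst (Large k) noColMates large′)
    ...   | no y≢y′  = 1+n≰n (begin
            1             ≡⟨ 𝟙-yes {a? = colMate? x y y′} (y≢y′ , same) ⟨
            𝟙 (colMate? x y y′) ≤⟨ term≤sumFin k (𝟙 ∘ colMate? x y) y′ ⟩
            colMates x y  ≡⟨ noColMates ⟩
            0             ∎)
      where open ≤-Reasoning

    lines-count : count horizontalLine? + count V.horizontalLine? ≤ k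
    lines-count = count-images horizontalLine? V.horizontalLine? lineColour V.lineColour
                               lineColour-injective V.lineColour-injective distinct
      where
      distinct : ∀ {y x} → HorizontalLine y → V.HorizontalLine x → lineColour y ≢ V.lineColour x
      distinct (_ , h) (_ , v) same = horizontal-vertical-colour h v
        (trans (sym (lineColour-horizontal h)) (trans same (V.lineColour-horizontal v)))

    mismatches≤5*irregulars : (σ : Permutation′ k) → (∀ {y} → HorizontalLine y → σ ⟨$⟩ʳ y ≡ lineColour y) →
      count V.horizontalLine? ≤ count horizontalLine? → mismatches f (λ _ y → σ ⟨$⟩ʳ y) ≤ 5 * irregulars
    mismatches≤5*irregulars σ agrees vv≤hh =
      stripe-balance (count-+-count-¬ horizontalLine?) lines-count vv≤hh rows-bound mismatches-bound
      where
      open ≤-Reasoning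
      misses vls : ℕ
      misses = count (¬? ∘ horizontalLine?)
      vls = count V.horizontalLine?
      mismatch-cases : ∀ {x y} → f x y ≢ σ ⟨$⟩ʳ y → (¬ HorizontalLine y ⊎ Irregular x y) ⊎ V.HorizontalLine x
      mismatch-cases {x} {y} mismatch with horizontalLine? y | horizontal? x y | vertical? x y
      ... | no ¬hl | _     | _     = inj₁ (inj₁ ¬hl)
      ... | yes hl | yes h | _     = contradiction (trans (sym (lineColour-horizontal h)) (sym (agrees hl))) mismatch
      ... | yes _  | no _  | yes v = inj₂ (y , v)
      ... | yes _  | no ¬h | no ¬v = inj₁ (inj₂ (¬h , ¬v))
      mismatches-bound : mismatches f (λ _ y → σ ⟨$⟩ʳ y) ≤ k * misses + irregulars + k * vls
      mismatches-bound = begin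
        mismatches f (λ _ y → σ ⟨$⟩ʳ y)
          ≤⟨ sumGrid-mono-≤ (λ x y → ≤-trans
               (𝟙-cover {a? = ¬? (f x y ≟ σ ⟨$⟩ʳ y)} {b? = ¬? (horizontalLine? y) ⊎-dec irregular? x y}
                        {c? = V.horizontalLine? x} mismatch-cases)
               (+-monoˡ-≤ (𝟙 (V.horizontalLine? x))
                          (𝟙-cover {a? = ¬? (horizontalLine? y) ⊎-dec irregular? x y} {b? = ¬? (horizontalLine? y)}
                                   {c? = irregular? x y} id))) ⟩
        sumGrid (λ x y → 𝟙 (¬? (horizontalLine? y)) + 𝟙 (irregular? x y) + 𝟙 (V.horizontalLine? x))
          ≡⟨ trans (sumGrid-distrib-+ _ (λ x _ → 𝟙 (V.horizontalLine? x)))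
                   (cong (_+ sumGrid (λ x _ → 𝟙 (V.horizontalLine? x)))
                         (sumGrid-distrib-+ (λ _ y → 𝟙 (¬? (horizontalLine? y))) (λ x y → 𝟙 (irregular? x y)))) ⟩
        sumGrid (λ _ y → 𝟙 (¬? (horizontalLine? y))) + irregulars + sumGrid (λ x _ → 𝟙 (V.horizontalLine? x))
          ≡⟨ cong₂ (λ a b → a + irregulars + b)
                   (sumGrid-row (𝟙 ∘ ¬? ∘ horizontalLine?)) (sumGrid-column (𝟙 ∘ V.horizontalLine?)) ⟩
        k * misses + irregulars + k * vls ∎
      row-cases : ∀ {x y} → ¬ HorizontalLine y → Irregular x y ⊎ (V.HorizontalLine x × ¬ HorizontalLine y)
      row-cases {x} {y} ¬hl with vertical? x y
      ... | yes v = inj₂ ((y , v) , ¬hl)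
      ... | no ¬v = inj₁ ((λ h → ¬hl (x , h)) , ¬v)
      rows-bound : k * misses ≤ irregulars + vls * misses
      rows-bound = begin
        k * misses
          ≡⟨ sumGrid-row (𝟙 ∘ ¬? ∘ horizontalLine?) ⟨
        sumGrid (λ _ y → 𝟙 (¬? (horizontalLine? y)))
          ≤⟨ sumGrid-mono-≤ (λ x y → ≤-trans
               (𝟙-cover {a? = ¬? (horizontalLine? y)} {b? = irregular? x y}
                        {c? = V.horizontalLine? x ×-dec ¬? (horizontalLine? y)} row-cases)
               (+-monoʳ-≤ _ (≤-reflexive (𝟙-× (V.horizontalLine? x) (¬? (horizontalLine? y)))))) ⟩
        sumGrid (λ x y → 𝟙 (irregular? x y) + 𝟙 (V.horizontalLine? x) * 𝟙 (¬? (horizontalLine? y)))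
          ≡⟨ trans (sumGrid-distrib-+ (λ x y → 𝟙 (irregular? x y))
                                      (λ x y → 𝟙 (V.horizontalLine? x) * 𝟙 (¬? (horizontalLine? y))))
                   (cong (irregulars +_) (sumFin-product k k (𝟙 ∘ V.horizontalLine?) (𝟙 ∘ ¬? ∘ horizontalLine?))) ⟩
        irregulars + vls * misses ∎

    horizontal-approximation : count V.horizontalLine? ≤ count horizontalLine? →
      ∃ λ (σ : Permutation′ k) → k * mismatches f (λ _ y → σ ⟨$⟩ʳ y) ≤ 120 * Rej
    horizontal-approximation vv≤hh
      with σ , agrees ← extend-partial-injection horizontalLine? lineColour lineColour-injective =
      σ , (begin
        k * mismatches f (λ _ y → σ ⟨$⟩ʳ y) ≤⟨ *-monoʳ-≤ k (mismatches≤5*irregulars σ agrees vv≤hh) ⟩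
        k * (5 * irregulars)                ≡⟨ *-comm-middle k 5 irregulars ⟩
        5 * (k * irregulars)                ≤⟨ *-monoʳ-≤ 5 k*irregulars≤24*Rej ⟩
        5 * (24 * Rej)                      ≡⟨ *-assoc 5 24 Rej ⟨
        120 * Rej                           ∎)
      where
      open ≤-Reasoning
      *-comm-middle : ∀ a b c → a * (b * c) ≡ b * (a * c)
      *-comm-middle = solve-∀

  striped-approximation : ∀ {k} → 3 ≤ k → (f : Coloring k) →
    ∃ λ g → Striped g × k * mismatches f g ≤ 120 * Statistics.Rej f
  striped-approximation {k} k≥3 f
    with count (Cells.horizontalLine? k≥3 (f ᵀ)) ≤? count (Cells.horizontalLine? k≥3 f)
  ... | yes vertical≤horizontal =
    let σ , bound = Striping.horizontal-approximation k≥3 f vertical≤horizontal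
    in (λ _ y → σ ⟨$⟩ʳ y) , inj₁ (σ , λ _ _ → refl) , bound
  ... | no vertical≰horizontal =
    let σ , bound = Striping.horizontal-approximation k≥3 (f ᵀ) (≰⇒≥ vertical≰horizontal)
    in (λ x _ → σ ⟨$⟩ʳ x) , inj₂ (σ , λ _ _ → refl) ,
       subst₂ (λ m r → k * m ≤ 120 * r) (mismatches-transpose f (λ x _ → σ ⟨$⟩ʳ x)) (Rej-transpose f) bound

  δ≡mismatches : ∀ {k} (f g : Coloring k) → δ f g ≡ frac (mismatches f g) (k * k)
  δ≡mismatches {k} f g =
    cong (λ m → frac m (k * k)) (sumGrid-cong (λ x y → ind-not-⌊⌋ (f x y ≟ g x y)))

  validPairs : ℕ → ℕ
  validPairs k = sumValid k (λ _ _ _ _ → true)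

  rejectProb≡Rej : ∀ {k} (f : Coloring k) → rejectProb f ≡ frac (Statistics.Rej f) (validPairs k)
  rejectProb≡Rej {k} f = cong (λ r → frac r (validPairs k)) (sumGrid-cong (λ x₁ y₁ → sumGrid-cong (λ x₂ y₂ →
    ind-⌊⌋-valid (x₁ ≟ x₂) (y₁ ≟ y₂) (f x₁ y₁ ≟ f x₂ y₂))))

  validPairs≤k⁴ : ∀ k → validPairs k ≤ (k * k) * (k * k)
  validPairs≤k⁴ k = begin
    validPairs k
      ≤⟨ sumGrid-mono-≤ {k} (λ _ _ → sumGrid-mono-≤ {k} (λ _ _ → ind≤1 _)) ⟩
    sumGrid {k} (λ _ _ → sumGrid {k} (λ _ _ → 1))  ≡⟨ sumGrid-cong {k} (λ _ _ → sumGrid-const {k} 1) ⟩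
    sumGrid {k} (λ _ _ → k * (k * 1))              ≡⟨ sumGrid-const {k} (k * (k * 1)) ⟩
    k * (k * (k * (k * 1)))                        ≡⟨ regroup k ⟩
    (k * k) * (k * k)                              ∎
    where
    open ≤-Reasoning
    regroup : ∀ k → k * (k * (k * (k * 1))) ≡ (k * k) * (k * k)
    regroup = solve-∀

  validPairs-pos : ∀ k → 1 ≤ validPairs (2 + k)
  validPairs-pos k = ≤-trans (term≤sumGrid {2 + k} (valid zero zero) (suc zero) (suc zero))
                             (term≤sumGrid {2 + k} (λ x₁ y₁ → sumGrid (valid x₁ y₁)) zero zero)
    where
    valid : Fin (2 + k) → Fin (2 + k) → Fin (2 + k) → Fin (2 + k) → ℕ
    valid x₁ y₁ x₂ y₂ = ind (not ⌊ x₁ ≟ x₂ ⌋ ∧ not ⌊ y₁ ≟ y₂ ⌋ ∧ true)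

module RationalBounds where

  open import Data.Nat using (ℕ; suc; _+_; _*_; _≤_)
  import Data.Nat.Properties as ℕ
  open import Data.Nat.Properties using (≤-trans; *-monoʳ-≤; *-monoˡ-≤)
  open import Data.Nat.Tactic.RingSolver using (solve-∀)
  open import Data.Integer using (+_; +≤+)
  import Data.Integer as ℤ
  import Data.Integer.Properties as ℤ
  open import Data.Rational using (ℚ; _<_; Positive; toℚᵘ) renaming (_*_ to _*ℚ_; _≤_ to _≤ℚ_)
  open import Data.Rational.Properties using (toℚᵘ-injective; toℚᵘ-homo-*; toℚᵘ-cancel-≤; toℚᵘ-fromℚᵘ;
    normalize-pos; *-monoˡ-<-pos; *-monoʳ-<-pos; module ≤-Reasoning)
  open import Data.Rational.Unnormalised using (mkℚᵘ; *≤*; *≡*) renaming (_*_ to _*ᵘ_)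
  import Data.Rational.Unnormalised.Properties as ℚᵘ
  open import Relation.Binary.PropositionalEquality

  frac-* : ∀ a m b n → frac a (suc m) *ℚ frac b (suc n) ≡ frac (a * b) (suc m * suc n)
  frac-* a m b n = toℚᵘ-injective (begin
    toℚᵘ (frac a (suc m) *ℚ frac b (suc n))          ≈⟨ toℚᵘ-homo-* (frac a (suc m)) (frac b (suc n)) ⟩
    toℚᵘ (frac a (suc m)) *ᵘ toℚᵘ (frac b (suc n))
      ≈⟨ ℚᵘ.*-cong (toℚᵘ-fromℚᵘ (mkℚᵘ (+ a) m)) (toℚᵘ-fromℚᵘ (mkℚᵘ (+ b) n)) ⟩
    mkℚᵘ (+ a) m *ᵘ mkℚᵘ (+ b) n                     ≈⟨ *≡* (cong (ℤ._* (+ (suc m * suc n))) (sym (ℤ.pos-* a b))) ⟩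
    mkℚᵘ (+ (a * b)) (n + m * suc n)                 ≈⟨ toℚᵘ-fromℚᵘ (mkℚᵘ (+ (a * b)) (n + m * suc n)) ⟨
    toℚᵘ (frac (a * b) (suc m * suc n))              ∎)
    where open ℚᵘ.≃-Reasoning

  frac-mono-≤ : ∀ a m b n → a * suc n ≤ b * suc m → frac a (suc m) ≤ℚ frac b (suc n)
  frac-mono-≤ a m b n le = toℚᵘ-cancel-≤
    (ℚᵘ.≤-respˡ-≃ (ℚᵘ.≃-sym (toℚᵘ-fromℚᵘ (mkℚᵘ (+ a) m)))
    (ℚᵘ.≤-respʳ-≃ (ℚᵘ.≃-sym (toℚᵘ-fromℚᵘ (mkℚᵘ (+ b) n)))
    (*≤* (subst₂ ℤ._≤_ (ℤ.pos-* a (suc n)) (ℤ.pos-* b (suc m)) (+≤+ le)))))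

  scaled-bound : ∀ {C K D R N} → 120 ≤ C → K * D ≤ 120 * R → N ≤ K * K * (K * K) →
    D * N ≤ R * (C * (K * K) * K)
  scaled-bound {C} {K} {D} {R} {N} 120≤C KD≤120R N≤K⁴ = begin
    D * N                   ≤⟨ *-monoʳ-≤ D N≤K⁴ ⟩
    D * (K * K * (K * K))   ≡⟨ regroup D K ⟩
    K * D * (K * K * K)     ≤⟨ *-monoˡ-≤ (K * K * K) (≤-trans KD≤120R (*-monoˡ-≤ R 120≤C)) ⟩
    C * R * (K * K * K)     ≡⟨ regroup′ C R K ⟩
    R * (C * (K * K) * K)   ∎
    where
    open ℕ.≤-Reasoning
    regroup : ∀ D K → D * (K * K * (K * K)) ≡ K * D * (K * K * K)
    regroup = solve-∀
    regroup′ : ∀ C R K → C * R * (K * K * K) ≡ R * (C * (K * K) * K)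
    regroup′ = solve-∀

  rejection-bound : ∀ c k {D R N} (ε : ℚ) → 120 ≤ suc c → ε < frac D (suc k * suc k) →
    suc k * D ≤ 120 * R → 1 ≤ N → N ≤ (suc k * suc k) * (suc k * suc k) →
    (frac 1 (suc c) *ℚ ε) *ℚ frac 1 (suc k) < frac R N
  rejection-bound c k {D} {R} {suc N} ε 120≤C ε<δ kD≤120R _ N≤K⁴ = begin-strict
    (frac 1 C *ℚ ε) *ℚ frac 1 K              <⟨ *-monoˡ-<-pos (frac 1 K) (*-monoʳ-<-pos (frac 1 C) ε<δ) ⟩
    (frac 1 C *ℚ frac D (K * K)) *ℚ frac 1 K ≡⟨ cong (_*ℚ frac 1 K) (frac-* 1 c D (k + k * K)) ⟩
    frac (1 * D) (C * (K * K)) *ℚ frac 1 K   ≡⟨ frac-* (1 * D) _ 1 k ⟩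
    frac (1 * D * 1) (C * (K * K) * K)       ≤⟨ frac-mono-≤ (1 * D * 1) _ R N
                                                  (subst (λ a → a * suc N ≤ R * (C * (K * K) * K)) (sym 1*D*1≡D)
                                                         (scaled-bound {C} {K} {D} {R} 120≤C kD≤120R N≤K⁴)) ⟩
    frac R (suc N)                           ∎
    where
    open ≤-Reasoning
    C K : ℕ
    C = suc c
    K = suc k
    instance
      1/C-pos : Positive (frac 1 C)
      1/C-pos = normalize-pos 1 C
      1/K-pos : Positive (frac 1 K)
      1/K-pos = normalize-pos 1 K
    1*D*1≡D : 1 * D * 1 ≡ D
    1*D*1≡D = trans (ℕ.*-identityʳ (1 * D)) (ℕ.*-identityˡ D)

open import Data.Nat using (ℕ; _≤_)
open import Data.Rational using (ℚ; _≤_; _<_; _*_; 0ℚ)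
open import Data.Nat using (zero; suc; s≤s)
open import Data.Nat.Properties using (≤-trans; m≤m+n)
open import Data.Product using (_,_)
open import Relation.Binary.PropositionalEquality using (sym; subst)
open Colourings using (module Statistics; mismatches; striped-approximation; rejectProb≡Rej; δ≡mismatches)
open Colourings using (validPairs-pos; validPairs≤k⁴)
open RationalBounds using (rejection-bound)

lemma5p7 : (k : ℕ) → 1000 Data.Nat.≤ k → (ε : ℚ) → 0ℚ Data.Rational.≤ ε →
    (f : Coloring k) → Far ε f → (ρ * ε) * frac 1 k < rejectProb f
lemma5p7 zero             ()
lemma5p7 (suc zero)       (s≤s ())
lemma5p7 k@(suc (suc k′)) 1000≤k ε _ f far =
  let g , striped , k*mismatches≤120*Rej = striped-approximation (≤-trans (m≤m+n 3 997) 1000≤k) f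
  in subst ((ρ * ε) * frac 1 k <_) (sym (rejectProb≡Rej f))
       (rejection-bound 99999999 (suc k′) {mismatches f g} {Statistics.Rej f} ε (m≤m+n 120 99999880)
         (subst (ε <_) (δ≡mismatches f g) (far g striped)) k*mismatches≤120*Rej
         (validPairs-pos k′) (validPairs≤k⁴ k))
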